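{- For grid graphs, $\mathrm{nim}(\mathrm{GEN}(P_{m}\square P_{n}))=\mathrm{pty}(mn)$.
   Context: A grid graph is the box (Cartesian) product $P_m\square P_n$ of path graphs with $2\le m\le n$ and $3\le n$. For a graph $G=(V,E)$, a set of vertices is geodetically convex if it contains every vertex on every shortest path between two of its vertices; the convex hull $[P]$ is the smallest convex set containing $P$, and $P$ is generating if $[P]=V$. In the achievement game $\mathrm{GEN}(G)$, two players alternately select previously-unselected vertices; the game ends as soon as the selected set generates, and the last player to move wins. $\mathrm{nim}$ denotes the nim-number of an impartial game, and $\mathrm{pty}(k):=k\bmod 2$. -}

module Defs where

open import Data.Nat using (ℕ; zero; suc; _+_; _*_; _≤_; _<_)
open import Data.Empty using (⊥)
open import Data.Fin using (Fin; toℕ; _≟_)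
open import Data.Bool using (Bool; true; false; if_then_else_; _∧_)
open import Data.Product using (Σ; _×_; _,_; ∃)
open import Data.Sum using (_⊎_)
open import Relation.Binary.PropositionalEquality using (_≡_; _≢_)
open import Relation.Nullary.Decidable using (⌊_⌋)

Vertex : ℕ → ℕ → Set
Vertex m n = Fin m × Fin n

PathAdj : {k : ℕ} → Fin k → Fin k → Set
PathAdj a b = (suc (toℕ a) ≡ toℕ b) ⊎ (suc (toℕ b) ≡ toℕ a)

GridAdj : {m n : ℕ} → Vertex m n → Vertex m n → Set
GridAdj (i , j) (i' , j') = (i ≡ i' × PathAdj j j') ⊎ (PathAdj i i' × j ≡ j')

data Walk {m n : ℕ} : Vertex m n → Vertex m n → ℕ → Set where
  here : (x : Vertex m n) → Walk x x 0
  step : {x y z : Vertex m n} {ℓ : ℕ} → GridAdj x y → Walk y z ℓ → Walk x z (suc ℓ)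

OnGeodesic : {m n : ℕ} → Vertex m n → Vertex m n → Vertex m n → Set
OnGeodesic {m} {n} x y z =
  Σ ℕ λ a → Σ ℕ λ b → Walk x z a × Walk z y b × (∀ ℓ → Walk {m} {n} x y ℓ → a + b ≤ ℓ)

VSet : ℕ → ℕ → Set
VSet m n = Vertex m n → Bool

_∈_ : {m n : ℕ} → Vertex m n → VSet m n → Set
v ∈ S = S v ≡ true

_⊆_ : {m n : ℕ} → VSet m n → VSet m n → Set
S ⊆ T = ∀ v → v ∈ S → v ∈ T

Convex : {m n : ℕ} → VSet m n → Set
Convex {m} {n} C = ∀ (x y z : Vertex m n) → x ∈ C → y ∈ C → OnGeodesic x y z → z ∈ C

InHull : {m n : ℕ} → VSet m n → Vertex m n → Set
InHull {m} {n} P v = ∀ (C : VSet m n) → Convex C → P ⊆ C → v ∈ C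

Generating : {m n : ℕ} → VSet m n → Set
Generating {m} {n} P = ∀ (v : Vertex m n) → InHull P v

select : {m n : ℕ} → VSet m n → Vertex m n → VSet m n
select P (i , j) (i' , j') = if ⌊ i ≟ i' ⌋ ∧ ⌊ j ≟ j' ⌋ then true else P (i' , j')

-- A position is the set P of selected vertices; the game ends (no options)
-- once P is generating; otherwise the options are P ∪ {v} for unselected v.
-- NimValue k P g : "position P has nim-number g", defined by recursion on a
-- bound k on the remaining number of moves (k = m * n suffices from ∅).
NimValue : {m n : ℕ} → ℕ → VSet m n → ℕ → Set
NimValue zero P g = Generating P × g ≡ 0
NimValue {m} {n} (suc k) P g =
  (Generating P × g ≡ 0)
  ⊎ ((Generating P → ⊥)
     × (∀ (v : Vertex m n) → P v ≡ false → ∀ g' → NimValue k (select P v) g' → g' ≢ g)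
     × (∀ h → h < g → Σ (Vertex m n) λ v → P v ≡ false × NimValue k (select P v) h))

∅ : {m n : ℕ} → VSet m n
∅ _ = false

NimGEN : ℕ → ℕ → ℕ → Set
NimGEN m n g = NimValue {m} {n} (m * n) ∅ g

{-# OPTIONS --safe #-}
module Submission where

-- A vertex set generates the grid iff it meets all four sides: the complement of a side
-- is convex, because a shortest path between two vertices off an extremal row (or
-- column) never touches it; conversely the hull of a set meeting every side contains the
-- two opposite corners, and every vertex lies on a geodesic between them.
--
-- If mn is even, the point reflection of the grid fixes no vertex.  A non-generating
-- centrosymmetric position misses a pair of opposite sides, so no single move completes
-- it, and answering every move by its mirror image restores centrosymmetry.  Hence these
-- positions, the empty one among them, have nim-number 0.
--
-- If m and n are odd, every side has an odd number of vertices.  Call a position blocked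
-- if it is not generating and no single move makes it generating.  A non-generating
-- position with an odd number of holes (unselected vertices) can either be completed by
-- selecting a corner (when it meets one of every two opposite sides) or moved to a blocked
-- position by selecting a vertex off a missed pair of opposite sides (one exists, since
-- otherwise the holes would be exactly those two sides, an even number of vertices).  A
-- non-generating position with an even number of holes has a move keeping it
-- non-generating, since otherwise its holes would be exactly one side.  By induction on the
-- number of holes, the former positions have value 1 and blocked ones with an even number
-- of holes have value 0; so the empty position has value 1.

open import Defs
open import Data.Bool using (Bool; true; false; not; _∧_; _∨_; if_then_else_)
open import Data.Bool.Properties using (∧-identityʳ; ∨-zeroʳ; ¬-not) renaming (_≟_ to _≟ᵇ_)
open import Data.Empty using (⊥)
open import Data.Fin as Fin using (Fin; zero; suc; toℕ; fromℕ; _≟_)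
open import Data.Fin.Properties using (any?; toℕ-injective; toℕ<n; toℕ≤pred[n]; toℕ-fromℕ; opposite-prop)
import Data.Fin.Properties as Fin
open import Data.Nat using (ℕ; zero; suc; _+_; _*_; _∸_; _≤_; _<_; _%_; z≤n; s≤s; s≤s⁻¹; ∣_-_∣; parity)
open import Data.Nat.Properties
  using (module ≤-Reasoning; suc-injective; ≤-reflexive; ≤-trans; ≤-total; ≤∧≢⇒<; <⇒≱; <-cmp; n≤1+n;
         m≤n+m; m≤m+n; +-mono-≤; +-mono-<-≤; +-monoʳ-≤; +-comm; +-identityʳ; *-identityˡ; *-identityʳ;
         m+[n∸m]≡n; m∸n+n≡m; m⊔n≤m+n; ∣-∣-triangle; ∣-∣-comm; ∣n-n∣≡0; ∣m-n∣≤m⊔n;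
         m≤n⇒∣m-n∣≡n∸m; m≤n⇒∣n-m∣≡n∸m; +-commutativeSemigroup; +-*-semiring)
open import Data.Parity.Base using (Parity; 0ℙ; 1ℙ; _⁻¹) renaming (_+_ to _+ℙ_; _*_ to _*ℙ_)
open import Data.Parity.Properties using (suc-homo-⁻¹; +-homo-+; *-homo-*; p+p⁻¹≡1ℙ; p+p≡0ℙ; ⁻¹-selfInverse)
open import Data.Product as Product using (∃; _×_; _,_; proj₁; proj₂)
open import Data.Sum as Sum using (_⊎_; inj₁; inj₂)
open import Function using (_∘_)
open import Relation.Binary.Definitions using (tri<; tri≈; tri>)
open import Relation.Binary.PropositionalEquality
  using (_≡_; _≢_; _≗_; refl; sym; trans; cong; cong₂; subst; subst₂; module ≡-Reasoning)
open import Relation.Nullary using (¬_; Dec; yes; no; contradiction)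
open import Relation.Nullary.Decidable using (⌊_⌋; ⌊⌋-map′; map′; _×-dec_; toSum)

open import Algebra.Properties.CommutativeSemigroup +-commutativeSemigroup
  using () renaming (interchange to +-interchange)
open import Algebra.Properties.Semiring.Sum +-*-semiring
  using (sum-syntax; ∑-distrib-+; sum-cong-≗; *-distribʳ-sum)

variable
  k m n ℓ ℓ′ : ℕ
  x y z : Vertex m n

⌊⌋-sound : ∀ {A : Set} (a? : Dec A) → ⌊ a? ⌋ ≡ true → A
⌊⌋-sound (yes a) _ = a

⌊⌋-complete : ∀ {A : Set} (a? : Dec A) → A → ⌊ a? ⌋ ≡ true
⌊⌋-complete (yes _) _ = refl
⌊⌋-complete (no ¬a) a = contradiction a ¬a

not-true : ∀ {b} → not b ≡ true → b ≡ false
not-true {false} _ = refl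

∧-true : ∀ {a b} → a ∧ b ≡ true → a ≡ true × b ≡ true
∧-true {true} {true} _ = refl , refl

∨-true : ∀ {a b} → a ∨ b ≡ true → a ≡ true ⊎ b ≡ true
∨-true {true} _ = inj₁ refl
∨-true {false} eq = inj₂ eq

∨-swap : ∀ a b c → a ∨ (b ∨ c) ≡ b ∨ (a ∨ c)
∨-swap true b c = sym (∨-zeroʳ b)
∨-swap false b c = refl

if-then-true : ∀ b {x} → (if b then true else x) ≡ b ∨ x
if-then-true true = refl
if-then-true false = refl

parity-suc : ∀ t → parity (suc t) ≡ parity t ⁻¹
parity-suc t = sym (⁻¹-selfInverse (suc-homo-⁻¹ t))

parity-pred : ∀ t {p} → parity (suc t) ≡ p → parity t ≡ p ⁻¹
parity-pred t eq = trans (sym (suc-homo-⁻¹ t)) (cong _⁻¹ eq)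

parity-n+suc[n] : ∀ t → parity (t + suc t) ≡ 1ℙ
parity-n+suc[n] t =
  trans (+-homo-+ t (suc t)) (trans (cong (parity t +ℙ_) (parity-suc t)) (p+p⁻¹≡1ℙ (parity t)))

parity-double : ∀ t → parity (t + t) ≡ 0ℙ
parity-double t = trans (+-homo-+ t t) (p+p≡0ℙ (parity t))

odd-factors : parity (m * n) ≡ 1ℙ → parity m ≡ 1ℙ × parity n ≡ 1ℙ
odd-factors {m} {n} odd = factors (parity m) (parity n) (trans (sym (*-homo-* m n)) odd)
  where
  factors : ∀ p q → p *ℙ q ≡ 1ℙ → p ≡ 1ℙ × q ≡ 1ℙ
  factors 1ℙ 1ℙ _ = refl , refl
  factors 0ℙ _ ()
  factors 1ℙ 0ℙ ()

parityBit : Parity → ℕ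
parityBit 0ℙ = 0
parityBit 1ℙ = 1

%2≡parityBit : ∀ t → t % 2 ≡ parityBit (parity t)
%2≡parityBit zero = refl
%2≡parityBit (suc zero) = refl
%2≡parityBit (suc (suc t)) = %2≡parityBit t

indicator : Bool → ℕ
indicator false = 0
indicator true = 1

indicator-∨ : ∀ a b → a ∧ b ≡ false → indicator (a ∨ b) ≡ indicator a + indicator b
indicator-∨ true false _ = refl
indicator-∨ false b _ = refl

count₁ : (Fin k → Bool) → ℕ
count₁ {k} A = ∑[ i < k ] indicator (A i)

count₁-true : count₁ {k} (λ _ → true) ≡ k
count₁-true {zero} = refl
count₁-true {suc k} = cong suc count₁-true

count₁-false : count₁ {k} (λ _ → false) ≡ 0
count₁-false {zero} = refl
count₁-false {suc k} = count₁-false {k}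

count₁-⁅⁆ : (i : Fin k) → count₁ (λ j → ⌊ i ≟ j ⌋) ≡ 1
count₁-⁅⁆ {suc k} zero = cong suc (count₁-false {k})
count₁-⁅⁆ (suc i) =
  trans (sum-cong-≗ (λ j → cong indicator (⌊⌋-map′ _ _ (i ≟ j)))) (count₁-⁅⁆ i)

count₁-∧ˡ : ∀ b (B : Fin k → Bool) → count₁ (λ j → b ∧ B j) ≡ indicator b * count₁ B
count₁-∧ˡ true B = sym (+-identityʳ (count₁ B))
count₁-∧ˡ {k} false B = count₁-false {k}

count₁-∪ : (A B : Fin k → Bool) → (∀ i → A i ∧ B i ≡ false) →
           count₁ (λ i → A i ∨ B i) ≡ count₁ A + count₁ B
count₁-∪ {k} A B disjoint =
  trans (sum-cong-≗ {k} (λ i → indicator-∨ (A i) (B i) (disjoint i))) (∑-distrib-+ {k} _ _)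

∁ : VSet m n → VSet m n
∁ S v = not (S v)

_∪_ : VSet m n → VSet m n → VSet m n
(S ∪ T) v = S v ∨ T v

rect : (Fin m → Bool) → (Fin n → Bool) → VSet m n
rect A B (i , j) = A i ∧ B j

⁅_⁆ : Vertex m n → VSet m n
⁅ i , j ⁆ = rect (λ i′ → ⌊ i ≟ i′ ⌋) (λ j′ → ⌊ j ≟ j′ ⌋)

count : VSet m n → ℕ
count {m} S = ∑[ i < m ] count₁ (λ j → S (i , j))

count-cong : {S T : VSet m n} → S ≗ T → count S ≡ count T
count-cong {m} {n} S≗T =
  sum-cong-≗ {m} (λ i → sum-cong-≗ {n} (λ j → cong indicator (S≗T (i , j))))

count-∪ : (S T : VSet m n) → (∀ v → S v ∧ T v ≡ false) → count (S ∪ T) ≡ count S + count T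
count-∪ {m} S T disjoint =
  trans (sum-cong-≗ {m} (λ i → count₁-∪ _ _ (λ j → disjoint (i , j)))) (∑-distrib-+ {m} _ _)

count-rect : (A : Fin m → Bool) (B : Fin n → Bool) → count (rect A B) ≡ count₁ A * count₁ B
count-rect {m} A B =
  trans (sum-cong-≗ {m} (λ i → count₁-∧ˡ (A i) B)) (sym (*-distribʳ-sum (count₁ B) (indicator ∘ A)))

count-⁅⁆ : (v : Vertex m n) → count ⁅ v ⁆ ≡ 1
count-⁅⁆ (i , j) =
  trans (count-rect (λ i′ → ⌊ i ≟ i′ ⌋) (λ j′ → ⌊ j ≟ j′ ⌋)) (cong₂ _*_ (count₁-⁅⁆ i) (count₁-⁅⁆ j))

holes : VSet m n → ℕ
holes P = count (∁ P)

holes-∅ : holes (∅ {m} {n}) ≡ m * n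
holes-∅ {m} {n} =
  trans (count-rect {m} {n} (λ _ → true) (λ _ → true)) (cong₂ _*_ (count₁-true {m}) (count₁-true {n}))

holes-exactly : {P T : VSet m n} → (∀ v → T v ≡ true → P v ≡ false) → (∀ v → P v ≡ false → T v ≡ true) →
                holes P ≡ count T
holes-exactly {P = P} {T} T⊆holes holes⊆T = count-cong pointwise
  where
  pointwise : ∀ v → not (P v) ≡ T v
  pointwise v with P v in eq
  ... | true = sym (¬-not λ v∈T → contradiction (trans (sym eq) (T⊆holes v v∈T)) λ ())
  ... | false = sym (holes⊆T v eq)

⁅⁆-sound : {v w : Vertex m n} → ⁅ v ⁆ w ≡ true → v ≡ w
⁅⁆-sound {v = i , j} {i′ , j′} eq with ∧-true eq
... | i≡ , j≡ = cong₂ _,_ (⌊⌋-sound (i ≟ i′) i≡) (⌊⌋-sound (j ≟ j′) j≡)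

⁅⁆-refl : (v : Vertex m n) → ⁅ v ⁆ v ≡ true
⁅⁆-refl (i , j) = cong₂ _∧_ (⌊⌋-complete (i ≟ i) refl) (⌊⌋-complete (j ≟ j) refl)

select-∨ : (P : VSet m n) (v w : Vertex m n) → select P v w ≡ ⁅ v ⁆ w ∨ P w
select-∨ P (i , j) (i′ , j′) = if-then-true (⌊ i ≟ i′ ⌋ ∧ ⌊ j ≟ j′ ⌋)

∈-select⁻ : {P : VSet m n} {v w : Vertex m n} → w ∈ select P v → v ≡ w ⊎ w ∈ P
∈-select⁻ {P = P} {v} {w} w∈ = Sum.map₁ ⁅⁆-sound (∨-true (trans (sym (select-∨ P v w)) w∈))

∈-select⁺ : {P : VSet m n} (v : Vertex m n) {w : Vertex m n} → w ∈ P → w ∈ select P v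
∈-select⁺ {P = P} v {w} w∈P =
  trans (select-∨ P v w) (trans (cong (⁅ v ⁆ w ∨_) w∈P) (∨-zeroʳ (⁅ v ⁆ w)))

∈-select-self : (P : VSet m n) (v : Vertex m n) → v ∈ select P v
∈-select-self P v = trans (select-∨ P v v) (cong (_∨ P v) (⁅⁆-refl v))

select-≢ : (P : VSet m n) {v w : Vertex m n} → v ≢ w → select P v w ≡ P w
select-≢ P {v} {w} v≢w = trans (select-∨ P v w) (cong (_∨ P w) (¬-not (v≢w ∘ ⁅⁆-sound)))

holes-select : (P : VSet m n) (v : Vertex m n) → P v ≡ false → holes P ≡ suc (holes (select P v))
holes-select P v hole = begin
  holes P                            ≡⟨ count-cong split ⟩
  count (⁅ v ⁆ ∪ ∁ (select P v))     ≡⟨ count-∪ ⁅ v ⁆ (∁ (select P v)) disjoint ⟩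
  count ⁅ v ⁆ + holes (select P v)   ≡⟨ cong (_+ holes (select P v)) (count-⁅⁆ v) ⟩
  suc (holes (select P v))           ∎
  where
  open ≡-Reasoning
  split : ∀ w → not (P w) ≡ ⁅ v ⁆ w ∨ not (select P v w)
  split w rewrite select-∨ P v w with ⁅ v ⁆ w in eq
  ... | true = cong not (subst (λ u → P u ≡ false) (⁅⁆-sound eq) hole)
  ... | false = refl
  disjoint : ∀ w → ⁅ v ⁆ w ∧ not (select P v w) ≡ false
  disjoint w rewrite select-∨ P v w with ⁅ v ⁆ w
  ... | true = refl
  ... | false = refl

holes-select-pred : (P : VSet m n) (v : Vertex m n) → P v ≡ false → holes P ≡ suc k →
                    holes (select P v) ≡ k
holes-select-pred P v hole holesP = suc-injective (trans (sym (holes-select P v hole)) holesP)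

-- Distance and geodesics

∣n-suc[n]∣≡1 : ∀ t → ∣ t - suc t ∣ ≡ 1
∣n-suc[n]∣≡1 zero = refl
∣n-suc[n]∣≡1 (suc t) = ∣n-suc[n]∣≡1 t

pathAdj⇒∣-∣≡1 : {a b : Fin k} → PathAdj a b → ∣ toℕ a - toℕ b ∣ ≡ 1
pathAdj⇒∣-∣≡1 {a = a} (inj₁ e) = trans (cong (λ t → ∣ toℕ a - t ∣) (sym e)) (∣n-suc[n]∣≡1 (toℕ a))
pathAdj⇒∣-∣≡1 {b = b} (inj₂ e) =
  trans (cong (λ t → ∣ t - toℕ b ∣) (sym e)) (trans (∣-∣-comm (suc (toℕ b)) (toℕ b)) (∣n-suc[n]∣≡1 (toℕ b)))

dist : Vertex m n → Vertex m n → ℕ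
dist (i , j) (i′ , j′) = ∣ toℕ i - toℕ i′ ∣ + ∣ toℕ j - toℕ j′ ∣

dist-self : (x : Vertex m n) → dist x x ≡ 0
dist-self (i , j) = cong₂ _+_ (∣n-n∣≡0 (toℕ i)) (∣n-n∣≡0 (toℕ j))

dist-triangle : (x y z : Vertex m n) → dist x z ≤ dist x y + dist y z
dist-triangle (a , b) (c , d) (e , f) = begin
  ∣ a′ - e′ ∣ + ∣ b′ - f′ ∣                                 ≤⟨ +-mono-≤ (∣-∣-triangle a′ c′ e′) (∣-∣-triangle b′ d′ f′) ⟩
  (∣ a′ - c′ ∣ + ∣ c′ - e′ ∣) + (∣ b′ - d′ ∣ + ∣ d′ - f′ ∣)   ≡⟨ +-interchange ∣ a′ - c′ ∣ ∣ c′ - e′ ∣ _ _ ⟩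
  (∣ a′ - c′ ∣ + ∣ b′ - d′ ∣) + (∣ c′ - e′ ∣ + ∣ d′ - f′ ∣)   ∎
  where
  open ≤-Reasoning
  a′ b′ c′ d′ e′ f′ : ℕ
  a′ = toℕ a; b′ = toℕ b; c′ = toℕ c; d′ = toℕ d; e′ = toℕ e; f′ = toℕ f

gridAdj⇒dist≡1 : GridAdj x y → dist x y ≡ 1
gridAdj⇒dist≡1 {x = i , j} (inj₁ (refl , adj)) = cong₂ _+_ (∣n-n∣≡0 (toℕ i)) (pathAdj⇒∣-∣≡1 adj)
gridAdj⇒dist≡1 {x = i , j} (inj₂ (adj , refl)) = cong₂ _+_ (pathAdj⇒∣-∣≡1 adj) (∣n-n∣≡0 (toℕ j))

walk⇒dist≤ : Walk x y ℓ → dist x y ≤ ℓ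
walk⇒dist≤ (here x) = ≤-reflexive (dist-self x)
walk⇒dist≤ {x = x} {y} {suc ℓ} (step {y = x′} adj w) = begin
  dist x y                ≤⟨ dist-triangle x x′ y ⟩
  dist x x′ + dist x′ y   ≡⟨ cong (_+ dist x′ y) (gridAdj⇒dist≡1 adj) ⟩
  suc (dist x′ y)         ≤⟨ s≤s (walk⇒dist≤ w) ⟩
  suc ℓ                   ∎
  where open ≤-Reasoning

_++ʷ_ : Walk x y ℓ → Walk y z ℓ′ → Walk x z (ℓ + ℓ′)
here _ ++ʷ w′ = w′
step adj w ++ʷ w′ = step adj (w ++ʷ w′)

gridAdj-sym : GridAdj x y → GridAdj y x
gridAdj-sym {x = _ , _} {y = _ , _} = Sum.map (Product.map sym Sum.swap) (Product.map Sum.swap sym)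

walk-snoc : Walk x y ℓ → GridAdj y z → Walk x z (suc ℓ)
walk-snoc (here _) adj = step adj (here _)
walk-snoc (step adj w) adj′ = step adj (walk-snoc w adj′)

walk-reverse : Walk x y ℓ → Walk y x ℓ
walk-reverse (here x) = here x
walk-reverse (step adj w) = walk-snoc (walk-reverse w) (gridAdj-sym adj)

PathLift : (Fin k → Vertex m n) → Set
PathLift f = ∀ {a b} → PathAdj a b → GridAdj (f a) (f b)

pathAdj-suc : {a b : Fin k} → PathAdj a b → PathAdj (suc a) (suc b)
pathAdj-suc = Sum.map (cong suc) (cong suc)

ascendingWalk : (f : Fin k → Vertex m n) → PathLift f →
                (a b : Fin k) → toℕ a ≤ toℕ b → Walk (f a) (f b) (toℕ b ∸ toℕ a)
ascendingWalk f lift zero zero _ = here (f zero)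
ascendingWalk {suc (suc k)} f lift zero (suc b) _ =
  step (lift (inj₁ refl)) (ascendingWalk (f ∘ suc) (lift ∘ pathAdj-suc) zero b z≤n)
ascendingWalk f lift (suc a) (suc b) (s≤s a≤b) = ascendingWalk (f ∘ suc) (lift ∘ pathAdj-suc) a b a≤b

lineWalk : (f : Fin k → Vertex m n) → PathLift f → (a b : Fin k) → Walk (f a) (f b) ∣ toℕ a - toℕ b ∣
lineWalk f lift a b with ≤-total (toℕ a) (toℕ b)
... | inj₁ a≤b =
  subst (Walk (f a) (f b)) (sym (m≤n⇒∣m-n∣≡n∸m a≤b)) (ascendingWalk f lift a b a≤b)
... | inj₂ b≤a =
  subst (Walk (f a) (f b)) (sym (m≤n⇒∣n-m∣≡n∸m b≤a)) (walk-reverse (ascendingWalk f lift b a b≤a))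

geodesicWalk : (x y : Vertex m n) → Walk x y (dist x y)
geodesicWalk (i , j) (i′ , j′) =
  lineWalk (_, j) (λ adj → inj₂ (adj , refl)) i i′ ++ʷ lineWalk (i′ ,_) (λ adj → inj₁ (refl , adj)) j j′

onGeodesic⇒between : {x y z : Vertex m n} → OnGeodesic x y z → dist x z + dist z y ≤ dist x y
onGeodesic⇒between {x = x} {y = y} (a , b , x→z , z→y , shortest) =
  ≤-trans (+-mono-≤ (walk⇒dist≤ x→z) (walk⇒dist≤ z→y)) (shortest (dist x y) (geodesicWalk x y))

between⇒onGeodesic : {x y z : Vertex m n} → dist x z + dist z y ≤ dist x y → OnGeodesic x y z
between⇒onGeodesic {x = x} {y = y} {z = z} between =
  dist x z , dist z y , geodesicWalk x z , geodesicWalk z y , λ ℓ w → ≤-trans between (walk⇒dist≤ w)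

∣-∣-detour : ∀ r x y → x ≢ r → y ≢ r → (r ≤ x × r ≤ y) ⊎ (x ≤ r × y ≤ r) →
             ∣ x - y ∣ < ∣ x - r ∣ + ∣ r - y ∣
∣-∣-detour zero zero _ x≢r _ _ = contradiction refl x≢r
∣-∣-detour zero (suc x) zero _ y≢r _ = contradiction refl y≢r
∣-∣-detour zero (suc x) (suc y) _ _ _ =
  s≤s (≤-trans (≤-trans (∣m-n∣≤m⊔n x y) (m⊔n≤m+n x y)) (+-monoʳ-≤ x (n≤1+n y)))
∣-∣-detour (suc r) zero zero _ _ _ = s≤s z≤n
∣-∣-detour (suc r) zero (suc y) _ _ (inj₁ (() , _))
∣-∣-detour (suc r) zero (suc y) _ y≢r (inj₂ (_ , s≤s y≤r)) =
  s≤s (≤-trans (≤∧≢⇒< y≤r (y≢r ∘ cong suc)) (m≤m+n r ∣ r - y ∣))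
∣-∣-detour (suc r) (suc x) zero _ _ (inj₁ (_ , ()))
∣-∣-detour (suc r) (suc x) zero x≢r _ (inj₂ (s≤s x≤r , _)) =
  ≤-trans (s≤s (≤∧≢⇒< x≤r (x≢r ∘ cong suc))) (m≤n+m (suc r) ∣ x - r ∣)
∣-∣-detour (suc r) (suc x) (suc y) x≢r y≢r sameSide =
  ∣-∣-detour r x y (x≢r ∘ cong suc) (y≢r ∘ cong suc)
    (Sum.map (Product.map s≤s⁻¹ s≤s⁻¹) (Product.map s≤s⁻¹ s≤s⁻¹) sameSide)

transpose : Vertex m n → Vertex n m
transpose (i , j) = j , i

dist-transpose : (x y : Vertex m n) → dist (transpose x) (transpose y) ≡ dist x y
dist-transpose (i , j) (i′ , j′) = +-comm ∣ toℕ j - toℕ j′ ∣ ∣ toℕ i - toℕ i′ ∣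

-- Sides of the grid

data End : Set where
  first last : End

other : End → End
other first = last
other last = first

endpoint : End → Fin (suc k)
endpoint first = zero
endpoint {k} last = fromℕ k

endpoint-extremal : (e : End) → (∀ (i : Fin (suc k)) → toℕ (endpoint {k} e) ≤ toℕ i)
                                ⊎ (∀ (i : Fin (suc k)) → toℕ i ≤ toℕ (endpoint {k} e))
endpoint-extremal first = inj₁ (λ _ → z≤n)
endpoint-extremal {k} last = inj₂ (λ i → subst (toℕ i ≤_) (sym (toℕ-fromℕ k)) (toℕ≤pred[n] i))

endpoint-≢-other : (e : End) → endpoint {suc k} e ≢ endpoint (other e)
endpoint-≢-other first ()
endpoint-≢-other last ()

data Side : Set where
  row col : End → Side

opposite : Side → Side
opposite (row e) = row (other e)
opposite (col e) = col (other e)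

opposite-involutive : (s : Side) → opposite (opposite s) ≡ s
opposite-involutive (row first) = refl
opposite-involutive (row last) = refl
opposite-involutive (col first) = refl
opposite-involutive (col last) = refl

side : Side → VSet (suc m) (suc n)
side (row e) (i , j) = ⌊ endpoint e ≟ i ⌋
side (col e) (i , j) = ⌊ endpoint e ≟ j ⌋

sideVertex : Side → Vertex (suc m) (suc n)
sideVertex (row e) = endpoint e , zero
sideVertex (col e) = zero , endpoint e

sideVertex-∈ : (s : Side) → sideVertex {m} {n} s ∈ side s
sideVertex-∈ (row e) = ⌊⌋-complete (endpoint e ≟ endpoint e) refl
sideVertex-∈ (col e) = ⌊⌋-complete (endpoint e ≟ endpoint e) refl

side-disjoint : (s : Side) {v : Vertex (2 + m) (2 + n)} → v ∈ side s → v ∈ side (opposite s) → ⊥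
side-disjoint (row e) {i , _} v∈s v∈opp =
  endpoint-≢-other e (trans (⌊⌋-sound (endpoint e ≟ i) v∈s) (sym (⌊⌋-sound (endpoint (other e) ≟ i) v∈opp)))
side-disjoint (col e) {_ , j} v∈s v∈opp =
  endpoint-≢-other e (trans (⌊⌋-sound (endpoint e ≟ j) v∈s) (sym (⌊⌋-sound (endpoint (other e) ≟ j) v∈opp)))

sideLength : Side → ℕ → ℕ → ℕ
sideLength (row _) m n = n
sideLength (col _) m n = m

count-side : (s : Side) → count (side {m} {n} s) ≡ sideLength s (suc m) (suc n)
count-side {m} {n} (row e) = begin
  count {suc m} {suc n} (side (row e))          ≡⟨ count-cong {S = side (row e)} {rect ⁅e⁆ (λ _ → true)} pointwise ⟩
  count {suc m} {suc n} (rect ⁅e⁆ (λ _ → true))  ≡⟨ count-rect {suc m} {suc n} ⁅e⁆ (λ _ → true) ⟩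
  count₁ ⁅e⁆ * count₁ {suc n} (λ _ → true)       ≡⟨ cong₂ _*_ (count₁-⁅⁆ (endpoint e)) (count₁-true {suc n}) ⟩
  1 * suc n                                      ≡⟨ *-identityˡ (suc n) ⟩
  suc n                                          ∎
  where
  open ≡-Reasoning
  ⁅e⁆ : Fin (suc m) → Bool
  ⁅e⁆ i = ⌊ endpoint e ≟ i ⌋
  pointwise : side (row e) ≗ rect ⁅e⁆ (λ (_ : Fin (suc n)) → true)
  pointwise (i , _) = sym (∧-identityʳ (⁅e⁆ i))
count-side {m} {n} (col e) = begin
  count {suc m} {suc n} (side (col e))           ≡⟨ count-rect {suc m} {suc n} (λ _ → true) ⁅e⁆ ⟩
  count₁ {suc m} (λ _ → true) * count₁ ⁅e⁆       ≡⟨ cong₂ _*_ (count₁-true {suc m}) (count₁-⁅⁆ (endpoint e)) ⟩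
  suc m * 1                                      ≡⟨ *-identityʳ (suc m) ⟩
  suc m                                          ∎
  where
  open ≡-Reasoning
  ⁅e⁆ : Fin (suc n) → Bool
  ⁅e⁆ j = ⌊ endpoint e ≟ j ⌋

count-side-opposite : (s : Side) → count (side {m} {n} (opposite s)) ≡ count (side {m} {n} s)
count-side-opposite {m} {n} (row e) = trans (count-side {m} {n} (row (other e))) (sym (count-side (row e)))
count-side-opposite {m} {n} (col e) = trans (count-side {m} {n} (col (other e))) (sym (count-side (col e)))

detour-via-side : (s : Side) {x y z : Vertex (suc m) (suc n)} →
                  side s x ≡ false → side s y ≡ false → side s z ≡ true → dist x y < dist x z + dist z y
detour-via-side {m} (row e) {a , b} {a′ , b′} {c , d} x∉ y∉ z∈ with ⌊⌋-sound (endpoint e ≟ c) z∈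
... | refl = begin-strict
  ∣ ta - ta′ ∣ + ∣ tb - tb′ ∣                                 <⟨ +-mono-<-≤ alongRows (∣-∣-triangle tb td tb′) ⟩
  (∣ ta - r ∣ + ∣ r - ta′ ∣) + (∣ tb - td ∣ + ∣ td - tb′ ∣)   ≡⟨ +-interchange ∣ ta - r ∣ ∣ r - ta′ ∣ _ _ ⟩
  (∣ ta - r ∣ + ∣ tb - td ∣) + (∣ r - ta′ ∣ + ∣ td - tb′ ∣)   ∎
  where
  open ≤-Reasoning
  ta ta′ tb tb′ td r : ℕ
  ta = toℕ a; ta′ = toℕ a′; tb = toℕ b; tb′ = toℕ b′; td = toℕ d; r = toℕ (endpoint {m} e)
  offRow : ∀ {i} → ⌊ endpoint e ≟ i ⌋ ≡ false → toℕ i ≢ r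
  offRow i∉ eq = contradiction (trans (sym (⌊⌋-complete (endpoint e ≟ _) (sym (toℕ-injective eq)))) i∉) λ ()
  alongRows : ∣ ta - ta′ ∣ < ∣ ta - r ∣ + ∣ r - ta′ ∣
  alongRows = ∣-∣-detour r ta ta′ (offRow x∉) (offRow y∉)
    (Sum.map (λ r≤ → r≤ a , r≤ a′) (λ ≤r → ≤r a , ≤r a′) (endpoint-extremal {m} e))
detour-via-side (col e) {x@(_ , _)} {y@(_ , _)} {z@(_ , _)} x∉ y∉ z∈ =
  subst₂ _<_ (dist-transpose x y) (cong₂ _+_ (dist-transpose x z) (dist-transpose z y))
    (detour-via-side (row e) {transpose x} {transpose y} {transpose z} x∉ y∉ z∈)

convex-∁side : (s : Side) → Convex (∁ (side {m} {n} s))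
convex-∁side s x y z x∉ y∉ geo with side s z in z∈
... | false = refl
... | true = contradiction (onGeodesic⇒between geo) (<⇒≱ (detour-via-side s (not-true x∉) (not-true y∉) z∈))

-- A set generates the grid iff it meets every side

record MeetsSide (P : VSet (suc m) (suc n)) (s : Side) : Set where
  constructor meets
  field
    vertex : Vertex (suc m) (suc n)
    vertex∈P : vertex ∈ P
    vertex∈side : vertex ∈ side s

MeetsAllSides : VSet (suc m) (suc n) → Set
MeetsAllSides P = ∀ s → MeetsSide P s

anyVertex? : {Q : Vertex m n → Set} → (∀ v → Dec (Q v)) → Dec (∃ Q)
anyVertex? Q? =
  map′ (λ (i , j , q) → (i , j) , q) (λ ((i , j) , q) → i , j , q) (any? λ i → any? λ j → Q? (i , j))

meetsSide? : (P : VSet (suc m) (suc n)) (s : Side) → Dec (MeetsSide P s)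
meetsSide? P s = map′ (λ (v , v∈P , v∈s) → meets v v∈P v∈s) (λ (meets v v∈P v∈s) → v , v∈P , v∈s)
  (anyVertex? (λ v → (P v ≟ᵇ true) ×-dec (side s v ≟ᵇ true)))

missesSide⇒hole : {P : VSet (suc m) (suc n)} {s : Side} {v : Vertex (suc m) (suc n)} →
                  ¬ MeetsSide P s → v ∈ side s → P v ≡ false
missesSide⇒hole misses v∈s = ¬-not (λ v∈P → misses (meets _ v∈P v∈s))

generating⇒meetsAllSides : {P : VSet (suc m) (suc n)} → Generating P → MeetsAllSides P
generating⇒meetsAllSides {P = P} generating s with meetsSide? P s
... | yes found = found
... | no misses = contradiction (trans (sym (sideVertex-∈ s)) (not-true sideVertex∉side)) λ ()
  where
  sideVertex∉side : sideVertex s ∈ ∁ (side s)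
  sideVertex∉side = generating (sideVertex s) (∁ (side s)) (convex-∁side s)
                      (λ v v∈P → cong not (¬-not λ v∈s → misses (meets v v∈P v∈s)))

elbow-dist : (x y : Vertex m n) → dist x (proj₁ y , proj₂ x) + dist (proj₁ y , proj₂ x) y ≡ dist x y
elbow-dist (p , q) (r , s) = cong₂ _+_
  (trans (cong (∣ toℕ p - toℕ r ∣ +_) (∣n-n∣≡0 (toℕ q))) (+-identityʳ _))
  (cong (_+ ∣ toℕ q - toℕ s ∣) (∣n-n∣≡0 (toℕ r)))

convex-elbow : {C : VSet m n} → Convex C → x ∈ C → y ∈ C → (proj₁ y , proj₂ x) ∈ C
convex-elbow {x = x} {y = y} convex x∈C y∈C =
  convex x y _ x∈C y∈C (between⇒onGeodesic (≤-reflexive (elbow-dist x y)))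

corners-dist : (v : Vertex (suc m) (suc n)) →
  dist (zero , zero) v + dist v (fromℕ m , fromℕ n) ≡ dist (zero , zero) (fromℕ m , fromℕ n)
corners-dist {m} {n} (i , j)
  rewrite toℕ-fromℕ m | toℕ-fromℕ n = begin
    (toℕ i + toℕ j) + (∣ toℕ i - m ∣ + ∣ toℕ j - n ∣)   ≡⟨ +-interchange (toℕ i) (toℕ j) _ _ ⟩
    (toℕ i + ∣ toℕ i - m ∣) + (toℕ j + ∣ toℕ j - n ∣)   ≡⟨ cong₂ _+_ (along (toℕ≤pred[n] i)) (along (toℕ≤pred[n] j)) ⟩
    m + n                                               ∎
  where
  open ≡-Reasoning
  along : ∀ {t M} → t ≤ M → t + ∣ t - M ∣ ≡ M
  along t≤M = trans (cong (_ +_) (m≤n⇒∣m-n∣≡n∸m t≤M)) (m+[n∸m]≡n t≤M)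

meetsAllSides⇒generating : {P : VSet (suc m) (suc n)} → MeetsAllSides P → Generating P
meetsAllSides⇒generating {m} {n} {P} meetsAll v C convex P⊆C =
  convex (zero , zero) (fromℕ m , fromℕ n) v (cornerAt first first) (cornerAt last last)
    (between⇒onGeodesic (≤-reflexive (corners-dist v)))
  where
  cornerAt : ∀ e e′ → (endpoint e , endpoint e′) ∈ C
  cornerAt e e′ with meetsAll (col e′) | meetsAll (row e)
  ... | meets x x∈P x∈col | meets y y∈P y∈row =
    subst (_∈ C) (cong₂ _,_ (sym (⌊⌋-sound _ y∈row)) (sym (⌊⌋-sound _ x∈col)))
      (convex-elbow convex (P⊆C x x∈P) (P⊆C y y∈P))

sideDichotomy : {A B : Side → Set} → (∀ s → A s ⊎ B s) → (∃ A) ⊎ (∀ s → B s)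
sideDichotomy f with f (row first) | f (row last) | f (col first) | f (col last)
... | inj₁ a | _ | _ | _ = inj₁ (_ , a)
... | inj₂ _ | inj₁ a | _ | _ = inj₁ (_ , a)
... | inj₂ _ | inj₂ _ | inj₁ a | _ = inj₁ (_ , a)
... | inj₂ _ | inj₂ _ | inj₂ _ | inj₁ a = inj₁ (_ , a)
... | inj₂ b₁ | inj₂ b₂ | inj₂ b₃ | inj₂ b₄ =
  inj₂ λ { (row first) → b₁ ; (row last) → b₂ ; (col first) → b₃ ; (col last) → b₄ }

missedSide-or-meetsAll : (P : VSet (suc m) (suc n)) → (∃ λ s → ¬ MeetsSide P s) ⊎ MeetsAllSides P
missedSide-or-meetsAll P = sideDichotomy (λ s → Sum.swap (toSum (meetsSide? P s)))

meetsAllSides? : (P : VSet (suc m) (suc n)) → Dec (MeetsAllSides P)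
meetsAllSides? P with missedSide-or-meetsAll P
... | inj₁ (s , misses) = no λ meetsAll → misses (meetsAll s)
... | inj₂ meetsAll = yes meetsAll

missedSide : {P : VSet (suc m) (suc n)} → ¬ MeetsAllSides P → ∃ λ s → ¬ MeetsSide P s
missedSide {P = P} ¬meetsAll with missedSide-or-meetsAll P
... | inj₁ missed = missed
... | inj₂ meetsAll = contradiction meetsAll ¬meetsAll

holes≡0⇒meetsAllSides : {P : VSet (suc m) (suc n)} → holes P ≡ 0 → MeetsAllSides P
holes≡0⇒meetsAllSides {P = P} noHoles s with meetsSide? P s
... | yes found = found
... | no misses = contradiction (trans (sym noHoles) (holes-select P (sideVertex s) sideVertex-hole)) λ ()
  where
  sideVertex-hole : P (sideVertex s) ≡ false
  sideVertex-hole = missesSide⇒hole misses (sideVertex-∈ s)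

meetsSide-select⁻ : {P : VSet (suc m) (suc n)} {v : Vertex (suc m) (suc n)} {s : Side} →
                    MeetsSide (select P v) s → MeetsSide P s ⊎ v ∈ side s
meetsSide-select⁻ {P = P} {v} (meets w w∈ w∈s) with ∈-select⁻ {P = P} {v} {w} w∈
... | inj₁ refl = inj₂ w∈s
... | inj₂ w∈P = inj₁ (meets w w∈P w∈s)

missesSide-select : {P : VSet (suc m) (suc n)} {v : Vertex (suc m) (suc n)} {s : Side} →
                    ¬ MeetsSide P s → side s v ≡ false → ¬ MeetsSide (select P v) s
missesSide-select misses v∉s found with meetsSide-select⁻ found
... | inj₁ meetsP = misses meetsP
... | inj₂ v∈s = contradiction (trans (sym v∈s) v∉s) λ ()

meetsAllSides-select : {P : VSet (suc m) (suc n)} {v : Vertex (suc m) (suc n)} →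
                       (∀ s → ¬ MeetsSide P s → v ∈ side s) → MeetsAllSides (select P v)
meetsAllSides-select {P = P} {v} onMissed s with meetsSide? P s
... | yes (meets w w∈P w∈s) = meets w (∈-select⁺ {P = P} v w∈P) w∈s
... | no misses = meets v (∈-select-self P v) (onMissed s misses)

missesOpposite-select : {P : VSet (2 + m) (2 + n)} {s : Side} → ¬ MeetsSide P s → ¬ MeetsSide P (opposite s) →
                        (v : Vertex (2 + m) (2 + n)) → ¬ MeetsAllSides (select P v)
missesOpposite-select {s = s} misses misses′ v meetsAll
  with meetsSide-select⁻ {v = v} (meetsAll s) | meetsSide-select⁻ {v = v} (meetsAll (opposite s))
... | inj₁ found | _ = misses found
... | inj₂ _ | inj₁ found = misses′ found
... | inj₂ v∈s | inj₂ v∈opp = side-disjoint s v∈s v∈opp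

oppositePairMissed-or-covered : (P : VSet (suc m) (suc n)) →
  (∃ λ s → ¬ MeetsSide P s × ¬ MeetsSide P (opposite s)) ⊎ (∀ s → MeetsSide P s ⊎ MeetsSide P (opposite s))
oppositePairMissed-or-covered P =
  sideDichotomy λ s → bothMissed-or-covered (meetsSide? P s) (meetsSide? P (opposite s))
  where
  bothMissed-or-covered : ∀ {A B : Set} → Dec A → Dec B → (¬ A × ¬ B) ⊎ (A ⊎ B)
  bothMissed-or-covered (yes a) _ = inj₂ (inj₁ a)
  bothMissed-or-covered (no _) (yes b) = inj₂ (inj₂ b)
  bothMissed-or-covered (no ¬a) (no ¬b) = inj₁ (¬a , ¬b)

uncoveredEnd : {M : End → Set} → Dec (M first) → M first ⊎ M last → ∃ λ e → ∀ e′ → ¬ M e′ → e′ ≡ e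
uncoveredEnd (yes m₁) _ = last , λ { first ¬m₁ → contradiction m₁ ¬m₁ ; last _ → refl }
uncoveredEnd (no ¬m₁) (inj₁ m₁) = contradiction m₁ ¬m₁
uncoveredEnd (no _) (inj₂ m₂) = first , λ { first _ → refl ; last ¬m₂ → contradiction m₂ ¬m₂ }

cornerMove : {P : VSet (suc m) (suc n)} → (∀ s → MeetsSide P s ⊎ MeetsSide P (opposite s)) →
             ¬ MeetsAllSides P → ∃ λ c → P c ≡ false × MeetsAllSides (select P c)
cornerMove {m} {n} {P} covered ¬meetsAll
  with uncoveredEnd {M = MeetsSide P ∘ row} (meetsSide? P (row first)) (covered (row first))
     | uncoveredEnd {M = MeetsSide P ∘ col} (meetsSide? P (col first)) (covered (col first))
     | missedSide ¬meetsAll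
... | eᵣ , rowMissed | e꜀ , colMissed | s , misses =
  c , missesSide⇒hole misses (onMissed s misses) , meetsAllSides-select onMissed
  where
  c : Vertex (suc m) (suc n)
  c = endpoint eᵣ , endpoint e꜀
  onMissed : ∀ s → ¬ MeetsSide P s → c ∈ side s
  onMissed (row e) misses = ⌊⌋-complete (endpoint e ≟ endpoint eᵣ) (cong endpoint (rowMissed e misses))
  onMissed (col e) misses = ⌊⌋-complete (endpoint e ≟ endpoint e꜀) (cong endpoint (colMissed e misses))

-- The point reflection

mirror : Vertex m n → Vertex m n
mirror (i , j) = Fin.opposite i , Fin.opposite j

mirror-involutive : (v : Vertex m n) → mirror (mirror v) ≡ v
mirror-involutive (i , j) = cong₂ _,_ (Fin.opposite-involutive i) (Fin.opposite-involutive j)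

Centrosymmetric : VSet m n → Set
Centrosymmetric P = ∀ v → P (mirror v) ≡ P v

opposite-injective : {i j : Fin k} → Fin.opposite i ≡ Fin.opposite j → i ≡ j
opposite-injective {i = i} {j} eq =
  trans (sym (Fin.opposite-involutive i)) (trans (cong Fin.opposite eq) (Fin.opposite-involutive j))

⌊opposite≟opposite⌋ : (i j : Fin k) → ⌊ Fin.opposite i ≟ Fin.opposite j ⌋ ≡ ⌊ i ≟ j ⌋
⌊opposite≟opposite⌋ i j with i ≟ j
... | yes refl = ⌊⌋-complete (Fin.opposite i ≟ Fin.opposite i) refl
... | no i≢j = ¬-not (i≢j ∘ opposite-injective ∘ ⌊⌋-sound (Fin.opposite i ≟ Fin.opposite j))

⁅⁆-mirror : (v w : Vertex m n) → ⁅ mirror v ⁆ (mirror w) ≡ ⁅ v ⁆ w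
⁅⁆-mirror (i , j) (i′ , j′) = cong₂ _∧_ (⌊opposite≟opposite⌋ i i′) (⌊opposite≟opposite⌋ j j′)

centrosymmetric-select² : {P : VSet m n} → Centrosymmetric P →
                          (v : Vertex m n) → Centrosymmetric (select (select P v) (mirror v))
centrosymmetric-select² {P = P} symmetric v w = begin
  select (select P v) (mirror v) (mirror w)       ≡⟨ select-∨ (select P v) (mirror v) (mirror w) ⟩
  ⁅ mirror v ⁆ (mirror w) ∨ select P v (mirror w)  ≡⟨ cong₂ _∨_ (⁅⁆-mirror v w) (select-∨ P v (mirror w)) ⟩
  ⁅ v ⁆ w ∨ (⁅ v ⁆ (mirror w) ∨ P (mirror w))      ≡⟨ cong (λ b → ⁅ v ⁆ w ∨ (b ∨ P (mirror w))) v↔mirror-w ⟩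
  ⁅ v ⁆ w ∨ (⁅ mirror v ⁆ w ∨ P (mirror w))        ≡⟨ cong (λ b → ⁅ v ⁆ w ∨ (⁅ mirror v ⁆ w ∨ b)) (symmetric w) ⟩
  ⁅ v ⁆ w ∨ (⁅ mirror v ⁆ w ∨ P w)                 ≡⟨ ∨-swap (⁅ v ⁆ w) (⁅ mirror v ⁆ w) (P w) ⟩
  ⁅ mirror v ⁆ w ∨ (⁅ v ⁆ w ∨ P w)                 ≡⟨ cong (⁅ mirror v ⁆ w ∨_) (select-∨ P v w) ⟨
  ⁅ mirror v ⁆ w ∨ select P v w                    ≡⟨ select-∨ (select P v) (mirror v) w ⟨
  select (select P v) (mirror v) w                 ∎
  where
  open ≡-Reasoning
  v↔mirror-w : ⁅ v ⁆ (mirror w) ≡ ⁅ mirror v ⁆ w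
  v↔mirror-w = trans (cong (λ u → ⁅ u ⁆ (mirror w)) (sym (mirror-involutive v))) (⁅⁆-mirror (mirror v) w)

opposite-endpoint : (e : End) → Fin.opposite (endpoint {k} e) ≡ endpoint (other e)
opposite-endpoint first = refl
opposite-endpoint last = Fin.opposite-involutive zero

mirror-side : (s : Side) {v : Vertex (suc m) (suc n)} → v ∈ side s → mirror v ∈ side (opposite s)
mirror-side (row e) {i , _} v∈s = ⌊⌋-complete (endpoint (other e) ≟ _)
  (trans (sym (opposite-endpoint e)) (cong Fin.opposite (⌊⌋-sound (endpoint e ≟ i) v∈s)))
mirror-side (col e) {_ , j} v∈s = ⌊⌋-complete (endpoint (other e) ≟ _)
  (trans (sym (opposite-endpoint e)) (cong Fin.opposite (⌊⌋-sound (endpoint e ≟ j) v∈s)))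

centrosymmetric-missesOpposite : {P : VSet (suc m) (suc n)} {s : Side} →
                                 Centrosymmetric P → ¬ MeetsSide P s → ¬ MeetsSide P (opposite s)
centrosymmetric-missesOpposite {s = s} symmetric misses (meets v v∈P v∈s) =
  misses (meets (mirror v) (trans (symmetric v) v∈P)
    (subst (λ t → mirror v ∈ side t) (opposite-involutive s) (mirror-side (opposite s) v∈s)))

opposite-fixed⇒odd : (i : Fin k) → Fin.opposite i ≡ i → parity k ≡ 1ℙ
opposite-fixed⇒odd {k} i fixed = trans (cong parity k≡t+suc[t]) (parity-n+suc[n] (toℕ i))
  where
  k≡t+suc[t] : k ≡ toℕ i + suc (toℕ i)
  k≡t+suc[t] = begin
    k                                 ≡⟨ m∸n+n≡m (toℕ<n i) ⟨
    (k ∸ suc (toℕ i)) + suc (toℕ i)   ≡⟨ cong (_+ suc (toℕ i)) (trans (sym (opposite-prop i)) (cong toℕ fixed)) ⟩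
    toℕ i + suc (toℕ i)               ∎
    where open ≡-Reasoning

mirror-fixed⇒odd : (v : Vertex m n) → mirror v ≡ v → parity (m * n) ≡ 1ℙ
mirror-fixed⇒odd {m} {n} (i , j) fixed = trans (*-homo-* m n)
  (cong₂ _*ℙ_ (opposite-fixed⇒odd i (cong proj₁ fixed)) (opposite-fixed⇒odd j (cong proj₂ fixed)))

mirror-hole : parity (m * n) ≡ 0ℙ → {P : VSet m n} → Centrosymmetric P →
              {v : Vertex m n} → P v ≡ false → select P v (mirror v) ≡ false
mirror-hole even {P} symmetric {v} hole = trans (select-≢ P v≢mirror) (trans (symmetric v) hole)
  where
  v≢mirror : v ≢ mirror v
  v≢mirror v≡mirror = contradiction (trans (sym even) (mirror-fixed⇒odd v (sym v≡mirror))) λ ()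

centrosymmetric-select-¬meetsAll : {P : VSet (2 + m) (2 + n)} → Centrosymmetric P → ¬ MeetsAllSides P →
                                   (v : Vertex (2 + m) (2 + n)) → ¬ MeetsAllSides (select P v)
centrosymmetric-select-¬meetsAll symmetric ¬meetsAll v with missedSide ¬meetsAll
... | s , misses = missesOpposite-select misses (centrosymmetric-missesOpposite symmetric misses) v

-- Nim-values

nimValue-generating : {P : VSet m n} → Generating P → NimValue k P 0
nimValue-generating {k = zero} generating = generating , refl
nimValue-generating {k = suc k} generating = inj₁ (generating , refl)

nimValue-unique : {P : VSet m n} {g g′ : ℕ} → NimValue k P g → NimValue k P g′ → g ≡ g′
nimValue-unique {k = zero} (_ , g≡0) (_ , g′≡0) = trans g≡0 (sym g′≡0)
nimValue-unique {k = suc k} (inj₁ (_ , g≡0)) (inj₁ (_ , g′≡0)) = trans g≡0 (sym g′≡0)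
nimValue-unique {k = suc k} (inj₁ (generating , _)) (inj₂ (¬generating , _)) =
  contradiction generating ¬generating
nimValue-unique {k = suc k} (inj₂ (¬generating , _)) (inj₁ (generating , _)) =
  contradiction generating ¬generating
nimValue-unique {k = suc k} {g = g} {g′} (inj₂ (_ , avoids , reaches)) (inj₂ (_ , avoids′ , reaches′))
  with <-cmp g g′
... | tri≈ _ g≡g′ _ = g≡g′
... | tri< g<g′ _ _ = let (v , hole , value) = reaches′ g g<g′ in contradiction refl (avoids v hole g value)
... | tri> _ _ g>g′ = let (v , hole , value) = reaches g′ g>g′ in contradiction refl (avoids′ v hole g′ value)

nimValue-option-≢ : {Q : VSet m n} {w : Vertex m n} {g h : ℕ} → NimValue (suc k) Q g → ¬ Generating Q →
                    Q w ≡ false → NimValue k (select Q w) h → g ≢ h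
nimValue-option-≢ (inj₁ (generating , _)) ¬generating = contradiction generating ¬generating
nimValue-option-≢ (inj₂ (_ , avoids , _)) _ hole value g≡h = avoids _ hole _ value (sym g≡h)

-- NimValue is indexed by a bound on the remaining moves and demands a generating position at
-- index 0; the lemmas below keep the index equal to the number of holes, so index 0 means a full
-- position.

module MirrorStrategy {m n : ℕ} (even : parity ((2 + m) * (2 + n)) ≡ 0ℙ) where

  private
    Position : Set
    Position = VSet (2 + m) (2 + n)

  mutual
    centrosymmetric⇒nimValue0 : (k : ℕ) (P : Position) → holes P ≡ k → Centrosymmetric P → NimValue k P 0
    centrosymmetric⇒nimValue0 zero P noHoles _ = meetsAllSides⇒generating (holes≡0⇒meetsAllSides noHoles) , refl
    centrosymmetric⇒nimValue0 (suc k) P holesP symmetric with meetsAllSides? P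
    ... | yes meetsAll = inj₁ (meetsAllSides⇒generating meetsAll , refl)
    ... | no ¬meetsAll =
      inj₂ (¬meetsAll ∘ generating⇒meetsAllSides , option-nimValue≢0 k P holesP symmetric ¬meetsAll , λ _ ())

    option-nimValue≢0 : (k : ℕ) (P : Position) → holes P ≡ suc k → Centrosymmetric P → ¬ MeetsAllSides P →
                        ∀ v → P v ≡ false → ∀ g → NimValue k (select P v) g → g ≢ 0
    option-nimValue≢0 zero P _ symmetric ¬meetsAll v _ _ (generating , _) =
      contradiction (generating⇒meetsAllSides generating) (centrosymmetric-select-¬meetsAll symmetric ¬meetsAll v)
    option-nimValue≢0 (suc k) P holesP symmetric ¬meetsAll v hole g value =
      nimValue-option-≢ value (centrosymmetric-select-¬meetsAll symmetric ¬meetsAll v ∘ generating⇒meetsAllSides)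
        mirrorHole (centrosymmetric⇒nimValue0 k _ holes′ (centrosymmetric-select² symmetric v))
      where
      mirrorHole : select P v (mirror v) ≡ false
      mirrorHole = mirror-hole even symmetric hole
      holes′ : holes (select (select P v) (mirror v)) ≡ k
      holes′ = holes-select-pred (select P v) (mirror v) mirrorHole (holes-select-pred P v hole holesP)

module OddGrid {m n : ℕ} (m-odd : parity (2 + m) ≡ 1ℙ) (n-odd : parity (2 + n) ≡ 1ℙ) where

  private
    Position : Set
    Position = VSet (2 + m) (2 + n)

  Blocked : Position → Set
  Blocked Q = ¬ MeetsAllSides Q × (∀ w → Q w ≡ false → ¬ MeetsAllSides (select Q w))

  side-odd : (s : Side) → parity (count (side {suc m} {suc n} s)) ≡ 1ℙ
  side-odd (row e) = trans (cong parity (count-side {suc m} {suc n} (row e))) n-odd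
  side-odd (col e) = trans (cong parity (count-side {suc m} {suc n} (col e))) m-odd

  oppositeSides-even : (s : Side) → parity (count {2 + m} {2 + n} (side s ∪ side (opposite s))) ≡ 0ℙ
  oppositeSides-even s = begin
    parity (count (side s ∪ side (opposite s)))  ≡⟨ cong parity (count-∪ (side s) (side (opposite s)) disjoint) ⟩
    parity (#s + count (side (opposite s)))      ≡⟨ cong (λ t → parity (#s + t)) (count-side-opposite s) ⟩
    parity (#s + #s)                             ≡⟨ parity-double #s ⟩
    0ℙ                                           ∎
    where
    open ≡-Reasoning
    #s : ℕ
    #s = count (side {suc m} {suc n} s)
    disjoint : ∀ v → side s v ∧ side (opposite s) v ≡ false
    disjoint v = ¬-not λ both → let (v∈s , v∈opp) = ∧-true both in side-disjoint s v∈s v∈opp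

  nonFinishingMove : {Q : Position} → parity (holes Q) ≡ 0ℙ → ¬ MeetsAllSides Q →
                     ∃ λ w → Q w ≡ false × ¬ MeetsAllSides (select Q w)
  nonFinishingMove {Q} even ¬meetsAll with missedSide ¬meetsAll
  ... | s , misses with anyVertex? (λ w → (Q w ≟ᵇ false) ×-dec (side s w ≟ᵇ false))
  ...   | yes (w , hole , w∉s) = w , hole , λ meetsAll → missesSide-select misses w∉s (meetsAll s)
  ...   | no noHoleOffSide = contradiction (trans (sym even) (trans (cong parity holesQ) (side-odd s))) λ ()
    where
    holesQ : holes Q ≡ count (side s)
    holesQ = holes-exactly (λ v → missesSide⇒hole misses)
                           (λ v hole → ¬-not λ v∉s → noHoleOffSide (v , hole , v∉s))

  pairMove : {P : Position} {s : Side} → parity (holes P) ≡ 1ℙ →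
             ¬ MeetsSide P s → ¬ MeetsSide P (opposite s) → ∃ λ u → P u ≡ false × Blocked (select P u)
  pairMove {P} {s} odd misses misses′
    with anyVertex? (λ u → (P u ≟ᵇ false) ×-dec ((side s u ≟ᵇ false) ×-dec (side (opposite s) u ≟ᵇ false)))
  ... | yes (u , hole , u∉s , u∉opp) =
    u , hole , missesOpposite-select misses misses′ u ,
    λ w _ → missesOpposite-select (missesSide-select misses u∉s) (missesSide-select misses′ u∉opp) w
  ... | no noHoleOffPair = contradiction (trans (sym odd) (trans (cong parity holesP) (oppositeSides-even s))) λ ()
    where
    holesP : holes P ≡ count (side s ∪ side (opposite s))
    holesP = holes-exactly (λ v → Sum.[ missesSide⇒hole misses , missesSide⇒hole misses′ ] ∘ ∨-true) onPair
      where
      onPair : ∀ v → P v ≡ false → (side s ∪ side (opposite s)) v ≡ true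
      onPair v hole with side s v in v∈s | side (opposite s) v in v∈opp
      ... | true | _ = refl
      ... | false | true = refl
      ... | false | false = contradiction (v , hole , v∈s , v∈opp) noHoleOffPair

  winningMove : {P : Position} → parity (holes P) ≡ 1ℙ → ¬ MeetsAllSides P →
                ∃ λ u → P u ≡ false × (MeetsAllSides (select P u) ⊎ Blocked (select P u))
  winningMove {P} odd ¬meetsAll with oppositePairMissed-or-covered P
  ... | inj₁ (s , misses , misses′) = Product.map₂ (Product.map₂ inj₂) (pairMove odd misses misses′)
  ... | inj₂ covered = Product.map₂ (Product.map₂ inj₁) (cornerMove covered ¬meetsAll)

  mutual
    oddHoles⇒nimValue1 : (k : ℕ) (P : Position) → holes P ≡ k → parity k ≡ 1ℙ → ¬ MeetsAllSides P →
                         NimValue k P 1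
    oddHoles⇒nimValue1 zero _ _ () _
    oddHoles⇒nimValue1 (suc k) P holesP odd ¬meetsAll =
      inj₂ (¬meetsAll ∘ generating⇒meetsAllSides ,
            option-nimValue≢1 k P holesP (parity-pred k odd) ,
            optionOfValue0)
      where
      optionOfValue0 : ∀ g → g < 1 → ∃ λ u → P u ≡ false × NimValue k (select P u) g
      optionOfValue0 zero _ with winningMove (trans (cong parity holesP) odd) ¬meetsAll
      ... | u , hole , inj₁ meetsAll = u , hole , nimValue-generating (meetsAllSides⇒generating meetsAll)
      ... | u , hole , inj₂ blocked =
        u , hole , blocked⇒nimValue0 k (select P u) (holes-select-pred P u hole holesP) (parity-pred k odd) blocked
      optionOfValue0 (suc _) (s≤s ())

    option-nimValue≢1 : (k : ℕ) (P : Position) → holes P ≡ suc k → parity k ≡ 0ℙ →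
                        ∀ v → P v ≡ false → ∀ g → NimValue k (select P v) g → g ≢ 1
    option-nimValue≢1 k P holesP even v hole g value with meetsAllSides? (select P v)
    ... | yes meetsAll = λ g≡1 → contradiction
      (trans (sym g≡1) (nimValue-unique value (nimValue-generating (meetsAllSides⇒generating meetsAll)))) λ ()
    ... | no ¬meetsAll =
      evenHoles⇒nimValue≢1 k (select P v) (holes-select-pred P v hole holesP) even ¬meetsAll g value

    evenHoles⇒nimValue≢1 : (k : ℕ) (Q : Position) → holes Q ≡ k → parity k ≡ 0ℙ → ¬ MeetsAllSides Q →
                           ∀ g → NimValue k Q g → g ≢ 1
    evenHoles⇒nimValue≢1 zero Q _ _ ¬meetsAll g (generating , _) =
      contradiction (generating⇒meetsAllSides generating) ¬meetsAll
    evenHoles⇒nimValue≢1 (suc k) Q holesQ even ¬meetsAll g value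
      with nonFinishingMove (trans (cong parity holesQ) even) ¬meetsAll
    ... | w , hole , ¬meetsAll′ =
      nimValue-option-≢ value (¬meetsAll ∘ generating⇒meetsAllSides) hole
        (oddHoles⇒nimValue1 k _ (holes-select-pred Q w hole holesQ) (parity-pred k even) ¬meetsAll′)

    blocked⇒nimValue0 : (k : ℕ) (Q : Position) → holes Q ≡ k → parity k ≡ 0ℙ → Blocked Q → NimValue k Q 0
    blocked⇒nimValue0 zero Q noHoles _ (¬meetsAll , _) = contradiction (holes≡0⇒meetsAllSides noHoles) ¬meetsAll
    blocked⇒nimValue0 (suc k) Q holesQ even (¬meetsAll , noFinish) =
      inj₂ (¬meetsAll ∘ generating⇒meetsAllSides , everyOptionHasValue1 , λ _ ())
      where
      everyOptionHasValue1 : ∀ w → Q w ≡ false → ∀ g → NimValue k (select Q w) g → g ≢ 0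
      everyOptionHasValue1 w hole g value g≡0 = contradiction (trans (sym g≡0) (nimValue-unique value
        (oddHoles⇒nimValue1 k _ (holes-select-pred Q w hole holesQ) (parity-pred k even) (noFinish w hole)))) λ ()

nimGEN-parity : (m n : ℕ) → NimGEN (2 + m) (2 + n) (parityBit (parity ((2 + m) * (2 + n))))
nimGEN-parity m n with parity ((2 + m) * (2 + n)) in mn-parity
... | 0ℙ = MirrorStrategy.centrosymmetric⇒nimValue0 {m} {n} mn-parity _ ∅ (holes-∅ {2 + m} {2 + n}) (λ _ → refl)
... | 1ℙ with odd-factors {2 + m} {2 + n} mn-parity
...   | m-odd , n-odd =
  OddGrid.oddHoles⇒nimValue1 m-odd n-odd _ ∅ (holes-∅ {2 + m} {2 + n}) mn-parity ∅-¬meetsAll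
  where
  ∅-¬meetsAll : ¬ MeetsAllSides {suc m} {suc n} ∅
  ∅-¬meetsAll meetsAll with meetsAll (row first)
  ... | meets _ () _

proposition7p15 : (m n : ℕ) → 2 ≤ m → m ≤ n → 3 ≤ n → NimGEN m n ((m * n) % 2)
proposition7p15 (suc (suc m)) (suc (suc n)) _ _ _ =
  subst (NimGEN (2 + m) (2 + n)) (sym (%2≡parityBit ((2 + m) * (2 + n)))) (nimGEN-parity m n)
proposition7p15 (suc zero) _ (s≤s ()) _ _
proposition7p15 (suc _) (suc zero) _ _ (s≤s ())
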